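{- For every fixed integer $\ell\ge 2$, as $n\to\infty$, $$\left(\frac{1}{(2\ell-2)^{1/2}}-o(1)\right)n^{1/2}\le m^0(n,C_{\ell,\ell})\le m^+(n,C_{\ell,\ell})\le(2\ell+o(1))n^{1/2}.$$
   Context: Digraphs have no loops and no parallel edges (opposite edges are allowed). $C_{\ell,\ell}$ is the digraph consisting of two vertices $x,y$ joined by two internally vertex-disjoint paths with $\ell$ edges each, both oriented from $x$ to $y$. A digraph is $C_{\ell,\ell}$-free if it has no subgraph isomorphic to $C_{\ell,\ell}$. $m^+(n,C_{\ell,\ell})$ (resp. $m^0(n,C_{\ell,\ell})$) is the largest possible minimum outdegree (resp. minimum semidegree $\min\{\delta^+,\delta^-\}$) of an $n$-vertex $C_{\ell,\ell}$-free digraph. -}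

module Defs where

open import Data.Nat using (ℕ; zero; suc; _≤_)
open import Data.Bool using (Bool; true; false; if_then_else_)
open import Data.Fin using (Fin; zero; suc; inject₁; fromℕ)
open import Data.List using (List; map; allFin)
open import Data.Nat.ListAction using (sum)
open import Data.Product using (Σ; ∃; _×_; _,_)
open import Data.Sum using (_⊎_)
open import Relation.Binary.PropositionalEquality using (_≡_)
open import Relation.Nullary using (¬_)
open import Function.Definitions using (Injective)
open import Data.Integer using (+_)
open import Data.Rational using (ℚ; _/_)

-- A digraph on vertex set Fin n: an arc relation (as a Bool-valued
-- adjacency function) with no loops.  Parallel edges are impossible by
-- construction; opposite arcs are allowed.
record Digraph (n : ℕ) : Set where
  field
    arc    : Fin n → Fin n → Bool
    noLoop : ∀ i → arc i i ≡ false
open Digraph public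

outdeg : ∀ {n} → Digraph n → Fin n → ℕ
outdeg {n} D i = sum (map (λ j → if arc D i j then 1 else 0) (allFin n))

indeg : ∀ {n} → Digraph n → Fin n → ℕ
indeg {n} D i = sum (map (λ j → if arc D j i then 1 else 0) (allFin n))

-- D contains a subgraph isomorphic to C_{ℓ,ℓ}: two directed paths
-- p = p₀ → p₁ → … → p_ℓ and q = q₀ → … → q_ℓ, each on ℓ+1 distinct
-- vertices, with p₀ = q₀ (= x), p_ℓ = q_ℓ (= y), and internally
-- vertex-disjoint (p i = q j only when both are the common start or
-- both are the common end).
ContainsCℓℓ : ∀ {n} → ℕ → Digraph n → Set
ContainsCℓℓ {n} ℓ D =
  Σ (Fin (suc ℓ) → Fin n) λ p →
  Σ (Fin (suc ℓ) → Fin n) λ q →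
    Injective _≡_ _≡_ p
  × Injective _≡_ _≡_ q
  × p zero ≡ q zero
  × p (fromℕ ℓ) ≡ q (fromℕ ℓ)
  × (∀ i j → p i ≡ q j →
       (i ≡ zero × j ≡ zero) ⊎ (i ≡ fromℕ ℓ × j ≡ fromℕ ℓ))
  × (∀ (i : Fin ℓ) → arc D (p (inject₁ i)) (p (suc i)) ≡ true)
  × (∀ (i : Fin ℓ) → arc D (q (inject₁ i)) (q (suc i)) ≡ true)

CℓℓFree : ∀ {n} → ℕ → Digraph n → Set
CℓℓFree ℓ D = ¬ ContainsCℓℓ ℓ D

MinOut≥ : ∀ {n} → Digraph n → ℕ → Set
MinOut≥ D k = ∀ i → k ≤ outdeg D i

MinOut≤ : ∀ {n} → Digraph n → ℕ → Set
MinOut≤ D k = ∃ λ i → outdeg D i ≤ k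

MinSemi≥ : ∀ {n} → Digraph n → ℕ → Set
MinSemi≥ D k = ∀ i → (k ≤ outdeg D i) × (k ≤ indeg D i)

MinSemi≤ : ∀ {n} → Digraph n → ℕ → Set
MinSemi≤ D k = ∃ λ i → (outdeg D i ≤ k) ⊎ (indeg D i ≤ k)

-- k = m⁺(n, C_{ℓ,ℓ}): the maximum over n-vertex C_{ℓ,ℓ}-free digraphs of
-- the minimum outdegree (attained, and an upper bound).
IsMPlus : ℕ → ℕ → ℕ → Set
IsMPlus ℓ n k =
    (Σ (Digraph n) λ D → CℓℓFree ℓ D × MinOut≥ D k)
  × (∀ (D : Digraph n) → CℓℓFree ℓ D → MinOut≤ D k)

IsMZero : ℕ → ℕ → ℕ → Set
IsMZero ℓ n k =
    (Σ (Digraph n) λ D → CℓℓFree ℓ D × MinSemi≥ D k)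
  × (∀ (D : Digraph n) → CℓℓFree ℓ D → MinSemi≤ D k)

ℕ→ℚ : ℕ → ℚ
ℕ→ℚ n = (+ n) / 1

module Submission where

-- From a vertex x grow, greedily and all at once, t paths
-- x → ⋯ of length ℓ − 1 whose vertices other than x are pairwise distinct
-- (possible while the fan has fewer than k vertices).  The last vertex of
-- each path still has k − (t (ℓ − 1) + 1) out-neighbours outside the fan,
-- and no vertex y is such an out-neighbour for two paths, since the two
-- paths extended by y would form a C_{ℓ,ℓ}.  Hence t (k − t (ℓ − 1) − 1) ≤ n,
-- and t ≈ k / (2ℓ − 2) gives k² ≤ 4ℓ² n.
--
-- Let m = 2ℓ − 2 and put an arc U → V on {0, …, n − 1} when
-- V ≡ U + 1 modulo m (K + 2) if U mod m < ℓ − 1, and modulo m (K + 1)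
-- otherwise.  Every arc advances the phase U mod m by one, so two paths of
-- length ℓ from x to y switch modulus at the same step j, 1 ≤ j ≤ ℓ − 1.
-- Walking forward from x and backward from y, their j-th vertices agree
-- modulo both moduli, hence coincide when n ≤ m (K + 1)(K + 2).  All in-
-- and out-degrees are at least n / (m (K + 2)), and K with
-- m K (K + 1) ≤ n ≤ m (K + 1)(K + 2) makes this about (n / m)^{1/2}.

module Counting where

  import Algebra.Properties.CommutativeMonoid.Sum as Sum
  open import Data.Bool using (Bool; true; false; if_then_else_; _∧_; _∨_; not)
  import Data.Bool.Properties as Bool
  open import Data.Fin using (Fin; zero; suc; toℕ; fromℕ<)
  open import Data.Fin.Properties using (any?; toℕ-fromℕ<) renaming (_≟_ to _≟ᶠ_)
  import Data.Fin.Properties as Fin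
  open import Data.List using (List; []; _∷_; length; map; tabulate)
  import Data.List.Membership.DecPropositional as DecMembership
  open import Data.List.Membership.Propositional using (_∉_)
  open import Data.Nat
  open import Data.Nat.DivMod using (m/n*n≤m)
  import Data.Nat.ListAction as List
  open import Data.Nat.Properties
  open import Data.Product using (∃; _×_; _,_)
  open import Function using (_∘_)
  open import Relation.Binary.PropositionalEquality
  open import Relation.Nullary using (does; yes; no; contradiction)

  open import Defs

  open Sum +-0-commutativeMonoid public using (sum; sum-syntax)
  open Sum +-0-commutativeMonoid using (sum-cong-≗; ∑-distrib-+; ∑-comm)

  module _ {n : ℕ} where
    open DecMembership (_≟ᶠ_ {n}) public using (_∈?_)

  𝟙 : Bool → ℕ
  𝟙 b = if b then 1 else 0

  count : ∀ {n} → (Fin n → Bool) → ℕ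
  count {n} P = ∑[ j < n ] 𝟙 (P j)

  module _ {A : Set} where

    sum-map-tabulate : ∀ {n} (f : A → ℕ) (g : Fin n → A) →
                       List.sum (map f (tabulate g)) ≡ ∑[ j < n ] f (g j)
    sum-map-tabulate {zero}  f g = refl
    sum-map-tabulate {suc n} f g = cong (f (g zero) +_) (sum-map-tabulate f (g ∘ suc))

  outdeg≡count : ∀ {n} (D : Digraph n) i → outdeg D i ≡ count (arc D i)
  outdeg≡count D i = sum-map-tabulate (λ j → 𝟙 (arc D i j)) (λ j → j)

  indeg≡count : ∀ {n} (D : Digraph n) i → indeg D i ≡ count (λ j → arc D j i)
  indeg≡count D i = sum-map-tabulate (λ j → 𝟙 (arc D j i)) (λ j → j)

  ∑-mono-≤ : ∀ {n} {f g : Fin n → ℕ} → (∀ j → f j ≤ g j) → sum f ≤ sum g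
  ∑-mono-≤ {zero}  f≤g = z≤n
  ∑-mono-≤ {suc n} f≤g = +-mono-≤ (f≤g zero) (∑-mono-≤ (f≤g ∘ suc))

  ∑-const : ∀ n c → ∑[ j < n ] c ≡ n * c
  ∑-const zero    c = refl
  ∑-const (suc n) c = cong (c +_) (∑-const n c)

  ∑-point : ∀ {n} (f : Fin n → ℕ) j → f j ≤ sum f
  ∑-point f zero    = m≤m+n _ _
  ∑-point f (suc j) = ≤-trans (∑-point (f ∘ suc) j) (m≤n+m _ _)

  𝟙≤1 : ∀ b → 𝟙 b ≤ 1
  𝟙≤1 true  = ≤-refl
  𝟙≤1 false = z≤n

  count≤n : ∀ {n} (P : Fin n → Bool) → count P ≤ n
  count≤n {n} P = begin
    count P          ≤⟨ ∑-mono-≤ (𝟙≤1 ∘ P) ⟩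
    ∑[ j < n ] 1     ≡⟨ ∑-const n 1 ⟩
    n * 1            ≡⟨ *-identityʳ n ⟩
    n                ∎
    where open ≤-Reasoning

  count-mono : ∀ {n} {P Q : Fin n → Bool} → (∀ j → P j ≡ true → Q j ≡ true) → count P ≤ count Q
  count-mono {P = P} {Q} P⇒Q = ∑-mono-≤ (λ j → 𝟙-mono (P j) (Q j) (P⇒Q j))
    where
    𝟙-mono : ∀ a b → (a ≡ true → b ≡ true) → 𝟙 a ≤ 𝟙 b
    𝟙-mono true  b a⇒b rewrite a⇒b refl = ≤-refl
    𝟙-mono false b a⇒b = z≤n

  count-∨ : ∀ {n} (P Q : Fin n → Bool) → count (λ j → P j ∨ Q j) ≤ count P + count Q
  count-∨ P Q = ≤-trans (∑-mono-≤ (λ j → 𝟙-∨ (P j) (Q j))) (≤-reflexive (∑-distrib-+ (𝟙 ∘ P) (𝟙 ∘ Q)))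
    where
    𝟙-∨ : ∀ a b → 𝟙 (a ∨ b) ≤ 𝟙 a + 𝟙 b
    𝟙-∨ true  b = s≤s z≤n
    𝟙-∨ false b = ≤-refl

  count-false : ∀ n → count {n} (λ _ → false) ≡ 0
  count-false n = trans (∑-const n 0) (*-zeroʳ n)

  count-singleton : ∀ {n} (v : Fin n) → count (λ j → does (j ≟ᶠ v)) ≡ 1
  count-singleton {suc n} zero    = cong suc (count-false n)
  count-singleton {suc n} (suc v) = count-singleton v

  count-∈ : ∀ {n} (U : List (Fin n)) → count (λ j → does (j ∈? U)) ≤ length U
  count-∈ {n} []      = ≤-reflexive (count-false n)
  count-∈     (u ∷ U) = begin
    count (λ j → does (j ≟ᶠ u) ∨ does (j ∈? U))                 ≤⟨ count-∨ (λ j → does (j ≟ᶠ u)) (λ j → does (j ∈? U)) ⟩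
    count (λ j → does (j ≟ᶠ u)) + count (λ j → does (j ∈? U))   ≤⟨ +-mono-≤ (≤-reflexive (count-singleton u)) (count-∈ U) ⟩
    suc (length U)                                              ∎
    where open ≤-Reasoning

  _∖_ : ∀ {n} → (Fin n → Bool) → List (Fin n) → Fin n → Bool
  (P ∖ U) j = P j ∧ not (does (j ∈? U))

  count-∖ : ∀ {n} (P : Fin n → Bool) U → count P ≤ count (P ∖ U) + length U
  count-∖ P U = begin
    count P                                             ≤⟨ ∑-mono-≤ (λ j → 𝟙-split (P j) (does (j ∈? U))) ⟩
    ∑[ j < _ ] (𝟙 ((P ∖ U) j) + 𝟙 (does (j ∈? U)))       ≡⟨ ∑-distrib-+ (𝟙 ∘ (P ∖ U)) (λ j → 𝟙 (does (j ∈? U))) ⟩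
    count (P ∖ U) + count (λ j → does (j ∈? U))          ≤⟨ +-monoʳ-≤ (count (P ∖ U)) (count-∈ U) ⟩
    count (P ∖ U) + length U                            ∎
    where
    open ≤-Reasoning
    𝟙-split : ∀ a b → 𝟙 a ≤ 𝟙 (a ∧ not b) + 𝟙 b
    𝟙-split true  true  = s≤s z≤n
    𝟙-split true  false = ≤-refl
    𝟙-split false b     = z≤n

  ∖⇒ : ∀ {n} {P : Fin n → Bool} {U : List (Fin n)} {j} → (P ∖ U) j ≡ true → P j ≡ true × j ∉ U
  ∖⇒ {P = P} {U} {j} eq with P j | j ∈? U
  ∖⇒ refl | true | no j∉U = refl , j∉U

  count>0⇒∃ : ∀ {n} (P : Fin n → Bool) → 0 < count P → ∃ λ j → P j ≡ true
  count>0⇒∃ {suc n} P pos with P zero in eq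
  ... | true  = zero , eq
  ... | false with count>0⇒∃ (P ∘ suc) pos
  ...   | j , Pj = suc j , Pj

  choose : ∀ {n} → (Fin n → Bool) → Fin n → Fin n
  choose P default with any? (λ j → P j Bool.≟ true)
  ... | yes (j , _) = j
  ... | no  _       = default

  choose-correct : ∀ {n} (P : Fin n → Bool) default → 0 < count P → P (choose P default) ≡ true
  choose-correct P default pos with any? (λ j → P j Bool.≟ true)
  ... | yes (_ , Pj) = Pj
  ... | no  ∄j       = contradiction (count>0⇒∃ P pos) ∄j

  count≤1 : ∀ {n} (P : Fin n → Bool) → (∀ i j → P i ≡ true → P j ≡ true → i ≡ j) → count P ≤ 1
  count≤1 {zero}  P unique = z≤n
  count≤1 {suc n} P unique with P zero in eq
  ... | true  = s≤s (≤-trans (count-mono {Q = λ _ → false} (λ j Pj → contradiction (unique zero (suc j) eq Pj) λ ()))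
                             (≤-reflexive (count-false n)))
  ... | false = count≤1 (P ∘ suc) (λ i j Pi Pj → Fin.suc-injective (unique (suc i) (suc j) Pi Pj))

  ∑-count-disjoint : ∀ {t n} (Q : Fin t → Fin n → Bool) →
                     (∀ j i i′ → Q i j ≡ true → Q i′ j ≡ true → i ≡ i′) →
                     ∑[ i < t ] count (Q i) ≤ n
  ∑-count-disjoint {t} {n} Q disjoint = begin
    ∑[ i < t ] ∑[ j < n ] 𝟙 (Q i j)   ≡⟨ ∑-comm (λ i j → 𝟙 (Q i j)) ⟩
    ∑[ j < n ] count (λ i → Q i j)    ≤⟨ ∑-mono-≤ (λ j → count≤1 (λ i → Q i j) (disjoint j)) ⟩
    ∑[ j < n ] 1                      ≡⟨ ∑-const n 1 ⟩
    n * 1                             ≡⟨ *-identityʳ n ⟩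
    n                                 ∎
    where open ≤-Reasoning

  ∑-split : ∀ a b (g : ℕ → ℕ) →
            ∑[ j < a + b ] g (toℕ j) ≡ ∑[ j < a ] g (toℕ j) + ∑[ j < b ] g (a + toℕ j)
  ∑-split zero    b g = refl
  ∑-split (suc a) b g = trans (cong (g 0 +_) (∑-split a b (g ∘ suc))) (sym (+-assoc (g 0) _ _))

  module _ (b : ℕ → Bool) (M : ℕ) .{{_ : NonZero M}} (periodic : ∀ x → b (M + x) ≡ b x)
           {e} (e<M : e < M) (hit : b e ≡ true) where

    private
      count-ℕ : ℕ → ℕ
      count-ℕ n = count {n} (b ∘ toℕ)

      count-ℕ-mono : ∀ {a c} → a ≤ c → count-ℕ a ≤ count-ℕ c
      count-ℕ-mono {a} {c} a≤c = begin
        count-ℕ a                                         ≤⟨ m≤m+n _ _ ⟩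
        count-ℕ a + ∑[ j < c ∸ a ] 𝟙 (b (a + toℕ j))      ≡⟨ ∑-split a (c ∸ a) (𝟙 ∘ b) ⟨
        count-ℕ (a + (c ∸ a))                             ≡⟨ cong count-ℕ (m+[n∸m]≡n a≤c) ⟩
        count-ℕ c                                         ∎
        where open ≤-Reasoning

      one-per-period : ∀ q → q ≤ count-ℕ (q * M)
      one-per-period zero    = z≤n
      one-per-period (suc q) = begin
        suc q                                          ≤⟨ +-mono-≤ first-period (one-per-period q) ⟩
        count-ℕ M + count-ℕ (q * M)                    ≡⟨ cong (count-ℕ M +_) (sum-cong-≗ {q * M} shift) ⟩
        count-ℕ M + ∑[ j < q * M ] 𝟙 (b (M + toℕ j))   ≡⟨ ∑-split M (q * M) (𝟙 ∘ b) ⟨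
        count-ℕ (suc q * M)                            ∎
        where
        open ≤-Reasoning
        first-period : 1 ≤ count-ℕ M
        first-period = ≤-trans (≤-reflexive (cong 𝟙 (sym (trans (cong b (toℕ-fromℕ< e<M)) hit))))
                               (∑-point (𝟙 ∘ b ∘ toℕ) (fromℕ< e<M))
        shift : ∀ (j : Fin (q * M)) → 𝟙 (b (toℕ j)) ≡ 𝟙 (b (M + toℕ j))
        shift j = cong 𝟙 (sym (periodic (toℕ j)))

    periodic-count : ∀ n → n / M ≤ count {n} (b ∘ toℕ)
    periodic-count n = ≤-trans (one-per-period (n / M)) (count-ℕ-mono (m/n*n≤m n M))


module UpperBound where

  open import Data.Bool using (Bool; true; if_then_else_)
  open import Data.Empty using (⊥-elim)
  open import Data.Fin using (Fin; zero; suc; toℕ; fromℕ; inject₁)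
  open import Data.Fin.Properties using (toℕ-injective; toℕ<n; toℕ-inject₁; toℕ-fromℕ) renaming (_≟_ to _≟ᶠ_)
  open import Function.Definitions using (Injective)
  open import Data.List using (List; []; _∷_; length)
  open import Data.List.Membership.Propositional using (_∈_; _∉_)
  open import Data.List.Relation.Unary.Any using (here; there)
  open import Data.Nat
  open import Data.Nat.DivMod using (_/_; _%_; m*n/n≡m; m<n⇒m/n≡0; +-distrib-/-∣ˡ; m/n*n≤m; m%n<n; m≡m%n+[m/n]*n)
  open import Data.Nat.Divisibility using (_∣_; _∣?_; n∣m*n; ∣m+n∣m⇒∣n; ∣⇒≤)
  open import Data.Nat.Properties
  open import Data.Nat.Tactic.RingSolver using (solve-∀)
  open import Data.Product using (_×_; _,_; proj₁; proj₂)
  open import Data.Sum using (_⊎_; inj₁; inj₂)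
  open import Function using (_∘_)
  open import Relation.Binary.PropositionalEquality
  open import Relation.Binary.Definitions using (tri<; tri≈; tri>)
  open import Relation.Nullary using (¬_; does; yes; no; contradiction)
  open import Relation.Nullary.Decidable using (dec-true; dec-false)

  open import Defs
  open Counting

  module GreedyFan {n} (D : Digraph n) (x : Fin n) (L : ℕ) {k} (deg : MinOut≥ D k) where

    H : ℕ
    H = suc L

    -- One sequence next 0, next 1, … grows all paths of the fan: the path of block i is
    -- x → next (i * H) → ⋯ → next (i * H + L), and each next c avoids x and all earlier ones.
    mutual
      history : ℕ → List (Fin n)
      history zero    = []
      history (suc c) = next c ∷ history c

      anchor : ℕ → Fin n
      anchor zero    = x
      anchor (suc c) = if does (H ∣? suc c) then x else next c

      next : ℕ → Fin n
      next c = choose (arc D (anchor c) ∖ (x ∷ history c)) x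

    length-history : ∀ c → length (history c) ≡ c
    length-history zero    = refl
    length-history (suc c) = cong suc (length-history c)

    ∈-history : ∀ {c′ c} → c′ < c → next c′ ∈ history c
    ∈-history {c′} {suc c} c′<1+c with m<1+n⇒m<n∨m≡n c′<1+c
    ... | inj₁ c′<c  = there (∈-history c′<c)
    ... | inj₂ refl = here refl

    anchor-∣ : ∀ {c} → H ∣ c → anchor c ≡ x
    anchor-∣ {zero}  _   = refl
    anchor-∣ {suc c} H∣c rewrite dec-true (H ∣? suc c) H∣c = refl

    anchor-∤ : ∀ {c} → ¬ H ∣ suc c → anchor (suc c) ≡ next c
    anchor-∤ {c} H∤c rewrite dec-false (H ∣? suc c) H∤c = refl

    count-avoiding : ∀ v U → k ≤ count (arc D v ∖ U) + length U
    count-avoiding v U = ≤-trans (subst (k ≤_) (outdeg≡count D v) (deg v)) (count-∖ (arc D v) U)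

    next-fresh : ∀ {c} → suc c < k → arc D (anchor c) (next c) ≡ true × next c ∉ x ∷ history c
    next-fresh {c} c+2≤k = ∖⇒ {P = arc D (anchor c)} (choose-correct fresh x 0<count)
      where
      open ≤-Reasoning
      fresh : Fin n → Bool
      fresh = arc D (anchor c) ∖ (x ∷ history c)
      0<count : 0 < count fresh
      0<count = +-cancelʳ-≤ (suc c) 1 (count fresh) (begin
        suc (suc c)                                     ≤⟨ c+2≤k ⟩
        k                                               ≤⟨ count-avoiding (anchor c) (x ∷ history c) ⟩
        count fresh + suc (length (history c))          ≡⟨ cong (λ l → count fresh + suc l) (length-history c) ⟩
        count fresh + suc c                             ∎)

    next-arc : ∀ {c} → suc c < k → arc D (anchor c) (next c) ≡ true
    next-arc = proj₁ ∘ next-fresh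

    next≢x : ∀ {c} → suc c < k → next c ≢ x
    next≢x c+2≤k eq = proj₂ (next-fresh c+2≤k) (here eq)

    next-injective : ∀ {c c′} → suc c < k → suc c′ < k → next c ≡ next c′ → c ≡ c′
    next-injective {c} {c′} c+2≤k c′+2≤k eq with <-cmp c c′
    ... | tri< c<c′ _ _ = contradiction (subst (_∈ history c′) eq (∈-history c<c′))
                                        (proj₂ (next-fresh c′+2≤k) ∘ there)
    ... | tri≈ _ c≡c′ _ = c≡c′
    ... | tri> _ _ c′<c = contradiction (subst (_∈ history c) (sym eq) (∈-history c′<c))
                                        (proj₂ (next-fresh c+2≤k) ∘ there)

    block-quotient : ∀ i {s} → s < H → (i * H + s) / H ≡ i
    block-quotient i {s} s<H = begin
      (i * H + s) / H     ≡⟨ +-distrib-/-∣ˡ s (n∣m*n i) ⟩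
      i * H / H + s / H   ≡⟨ cong₂ _+_ (m*n/n≡m i H) (m<n⇒m/n≡0 s<H) ⟩
      i + 0               ≡⟨ +-identityʳ i ⟩
      i                   ∎
      where open ≡-Reasoning

    block-index-injective : ∀ {i i′ s s′} → s < H → s′ < H → i * H + s ≡ i′ * H + s′ → i ≡ i′ × s ≡ s′
    block-index-injective {i} {i′} {s} {s′} s<H s′<H eq =
      i≡i′ , +-cancelˡ-≡ (i * H) s s′ (trans eq (cong (λ j → j * H + s′) (sym i≡i′)))
      where
      i≡i′ : i ≡ i′
      i≡i′ = trans (sym (block-quotient i s<H)) (trans (cong (_/ H) eq) (block-quotient i′ s′<H))

    module Fan (t : ℕ) (tH<k : t * H < k) where

      T : ℕ
      T = t * H

      inner-index< : ∀ (i : Fin t) {s} → s < H → toℕ i * H + s < T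
      inner-index< i {s} s<H = begin-strict
        toℕ i * H + s   <⟨ +-monoʳ-< (toℕ i * H) s<H ⟩
        toℕ i * H + H   ≡⟨ +-comm (toℕ i * H) H ⟩
        suc (toℕ i) * H ≤⟨ *-monoˡ-≤ H (toℕ<n i) ⟩
        T               ∎
        where open ≤-Reasoning

      inner-fresh : ∀ (i : Fin t) {s} → s < H → suc (toℕ i * H + s) < k
      inner-fresh i s<H = <-≤-trans (s≤s (inner-index< i s<H)) tH<k

      route : Fin t → Fin n → ℕ → Fin n
      route i y zero    = x
      route i y (suc s) with s <? H
      ... | yes _ = next (toℕ i * H + s)
      ... | no  _ = y

      route-inner : ∀ i y {s} → s < H → route i y (suc s) ≡ next (toℕ i * H + s)
      route-inner i y {s} s<H with s <? H
      ... | yes _   = refl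
      ... | no  s≮H = contradiction s<H s≮H

      route-end : ∀ i y → route i y (suc H) ≡ y
      route-end i y with H <? H
      ... | yes H<H = contradiction H<H (<-irrefl refl)
      ... | no  _   = refl

      data Slot : ℕ → Set where
        start : Slot 0
        inner : ∀ {s} → s < H → Slot (suc s)
        end   : Slot (suc H)

      slot : ∀ {a} → a ≤ suc H → Slot a
      slot {zero}  _   = start
      slot {suc s} a≤ with s <? H
      ... | yes s<H = inner s<H
      ... | no  s≮H rewrite ≤-antisym (s≤s⁻¹ a≤) (≮⇒≥ s≮H) = end

      module _ {y} (y∉ : y ∉ x ∷ history T) where

        route≡x : ∀ i {a} → a ≤ suc H → route i y a ≡ x → a ≡ 0
        route≡x i a≤ eq with slot a≤
        ... | start     = refl
        ... | inner s<H = contradiction (trans (sym (route-inner i y s<H)) eq) (next≢x (inner-fresh i s<H))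
        ... | end       = contradiction (here (trans (sym (route-end i y)) eq)) y∉

        route≡y : ∀ i {a} → a ≤ suc H → route i y a ≡ y → a ≡ suc H
        route≡y i a≤ eq with slot a≤
        ... | start     = contradiction (here (sym eq)) y∉
        ... | inner s<H = contradiction (subst (_∈ history T) (trans (sym (route-inner i y s<H)) eq)
                                               (∈-history (inner-index< i s<H)))
                                        (y∉ ∘ there)
        ... | end       = refl

        route-meet : ∀ i i′ {a b} → a ≤ suc H → b ≤ suc H → route i y a ≡ route i′ y b →
                     (a ≡ 0 × b ≡ 0) ⊎ (a ≡ suc H × b ≡ suc H) ⊎ (i ≡ i′ × a ≡ b)
        route-meet i i′ a≤ b≤ eq with slot a≤ | slot b≤
        ... | start     | _           = inj₁ (refl , route≡x i′ b≤ (sym eq))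
        ... | end       | _           = inj₂ (inj₁ (refl , route≡y i′ b≤ (trans (sym eq) (route-end i y))))
        ... | inner _   | start       = contradiction (route≡x i a≤ eq) λ ()
        ... | inner s<H | end         = contradiction (route≡y i a≤ (trans eq (route-end i′ y))) (<⇒≢ (s≤s s<H))
        ... | inner s<H | inner s′<H  =
          let (i≡i′ , s≡s′) = block-index-injective s<H s′<H
                (next-injective (inner-fresh i s<H) (inner-fresh i′ s′<H)
                  (trans (sym (route-inner i y s<H)) (trans eq (route-inner i′ y s′<H))))
          in inj₂ (inj₂ (toℕ-injective i≡i′ , cong suc s≡s′))

      tip : Fin t → Fin n
      tip i = next (toℕ i * H + L)

      route-arc : ∀ i {y} → arc D (tip i) y ≡ true →
                  ∀ {s} → s ≤ H → arc D (route i y s) (route i y (suc s)) ≡ true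
      route-arc i {y} tip→y {zero} _ = begin
        arc D x (route i y 1)                                   ≡⟨ cong₂ (arc D) (sym (anchor-∣ H∣iH+0))
                                                                                  (route-inner i y 0<H) ⟩
        arc D (anchor (toℕ i * H + 0)) (next (toℕ i * H + 0))   ≡⟨ next-arc (inner-fresh i 0<H) ⟩
        true                                                    ∎
        where
        open ≡-Reasoning
        0<H : 0 < H
        0<H = s≤s z≤n
        H∣iH+0 : H ∣ toℕ i * H + 0
        H∣iH+0 = subst (H ∣_) (sym (+-identityʳ _)) (n∣m*n (toℕ i))
      route-arc i {y} tip→y {suc s} 1+s≤H with m≤n⇒m<n∨m≡n 1+s≤H
      ... | inj₁ 1+s<H = begin
        arc D (route i y (suc s)) (route i y (suc (suc s)))   ≡⟨ cong₂ (arc D) (route-inner i y 1+s≤H)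
                                                                                (route-inner i y 1+s<H) ⟩
        arc D (next c) (next (toℕ i * H + suc s))             ≡⟨ cong₂ (arc D) (sym (anchor-∤ H∤1+c))
                                                                                (cong next (+-suc _ s)) ⟩
        arc D (anchor (suc c)) (next (suc c))                 ≡⟨ next-arc (subst (λ c → suc c < k) (+-suc _ s)
                                                                                   (inner-fresh i 1+s<H)) ⟩
        true                                                  ∎
        where
        open ≡-Reasoning
        c : ℕ
        c = toℕ i * H + s
        H∤1+c : ¬ H ∣ suc c
        H∤1+c H∣1+c = <⇒≱ 1+s<H (∣⇒≤ (∣m+n∣m⇒∣n (subst (H ∣_) (sym (+-suc _ s)) H∣1+c)
                                                (n∣m*n (toℕ i))))
      ... | inj₂ refl = begin
        arc D (route i y (suc L)) (route i y (suc H)) ≡⟨ cong₂ (arc D) (route-inner i y ≤-refl) (route-end i y) ⟩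
        arc D (tip i) y                               ≡⟨ tip→y ⟩
        true                                          ∎
        where open ≡-Reasoning

      fan-cycle : ∀ {i i′ y} → i ≢ i′ → y ∉ x ∷ history T →
                  arc D (tip i) y ≡ true → arc D (tip i′) y ≡ true → ContainsCℓℓ (suc H) D
      fan-cycle {i} {i′} {y} i≢i′ y∉ tip→y tip′→y =
        path i , path i′ , injective i , injective i′ , refl , ends , internally-disjoint ,
        arcs i tip→y , arcs i′ tip′→y
        where
        path : Fin t → Fin (suc (suc H)) → Fin n
        path j f = route j y (toℕ f)

        ≤1+H : (f : Fin (suc (suc H))) → toℕ f ≤ suc H
        ≤1+H f = s≤s⁻¹ (toℕ<n f)

        injective : ∀ j → Injective _≡_ _≡_ (path j)
        injective j {f} {f′} eq with route-meet y∉ j j (≤1+H f) (≤1+H f′) eq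
        ... | inj₁ (f≡0 , f′≡0)        = toℕ-injective (trans f≡0 (sym f′≡0))
        ... | inj₂ (inj₁ (f≡ℓ , f′≡ℓ)) = toℕ-injective (trans f≡ℓ (sym f′≡ℓ))
        ... | inj₂ (inj₂ (_ , f≡f′))   = toℕ-injective f≡f′

        path-end : ∀ j → path j (fromℕ (suc H)) ≡ y
        path-end j = trans (cong (route j y) (toℕ-fromℕ (suc H))) (route-end j y)

        ends : path i (fromℕ (suc H)) ≡ path i′ (fromℕ (suc H))
        ends = trans (path-end i) (sym (path-end i′))

        internally-disjoint : ∀ f f′ → path i f ≡ path i′ f′ →
                              (f ≡ zero × f′ ≡ zero) ⊎ (f ≡ fromℕ (suc H) × f′ ≡ fromℕ (suc H))
        internally-disjoint f f′ eq with route-meet y∉ i i′ (≤1+H f) (≤1+H f′) eq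
        ... | inj₁ (f≡0 , f′≡0)        = inj₁ (toℕ-injective f≡0 , toℕ-injective f′≡0)
        ... | inj₂ (inj₁ (f≡ℓ , f′≡ℓ)) = inj₂ (toℕ-injective (trans f≡ℓ (sym (toℕ-fromℕ _))) ,
                                               toℕ-injective (trans f′≡ℓ (sym (toℕ-fromℕ _))))
        ... | inj₂ (inj₂ (i≡i′ , _))   = contradiction i≡i′ i≢i′

        arcs : ∀ j → arc D (tip j) y ≡ true → ∀ (f : Fin (suc H)) →
               arc D (path j (inject₁ f)) (path j (suc f)) ≡ true
        arcs j tip→y f rewrite toℕ-inject₁ f = route-arc j tip→y (s≤s⁻¹ (toℕ<n f))

      escape : Fin t → Fin n → Bool
      escape i = arc D (tip i) ∖ (x ∷ history T)

      fan-bound : CℓℓFree (suc H) D → t * (k ∸ suc T) ≤ n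
      fan-bound free = begin
        t * (k ∸ suc T)               ≡⟨ ∑-const t (k ∸ suc T) ⟨
        ∑[ i < t ] (k ∸ suc T)        ≤⟨ ∑-mono-≤ escape-large ⟩
        ∑[ i < t ] count (escape i)   ≤⟨ ∑-count-disjoint escape escapes-disjoint ⟩
        n                             ∎
        where
        open ≤-Reasoning
        escape-large : ∀ i → k ∸ suc T ≤ count (escape i)
        escape-large i = m≤n+o⇒m∸n≤o k (suc T) (begin
          k                                                 ≤⟨ count-avoiding (tip i) (x ∷ history T) ⟩
          count (escape i) + suc (length (history T))       ≡⟨ cong (λ l → count (escape i) + suc l) (length-history T) ⟩
          count (escape i) + suc T                          ≡⟨ +-comm _ (suc T) ⟩
          suc T + count (escape i)                          ∎)
        escapes-disjoint : ∀ y i i′ → escape i y ≡ true → escape i′ y ≡ true → i ≡ i′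
        escapes-disjoint y i i′ escᵢ escᵢ′ with i ≟ᶠ i′
        ... | yes i≡i′ = i≡i′
        ... | no  i≢i′ =
          let (tip→y , y∉) = ∖⇒ {P = arc D (tip i)} {x ∷ history T} escᵢ
              (tip′→y , _) = ∖⇒ {P = arc D (tip i′)} {x ∷ history T} escᵢ′
          in ⊥-elim (free (fan-cycle i≢i′ y∉ tip→y tip′→y))

  square-bound : ∀ H t r n → r < H + H → t * (t * H + r) ≤ n → suc (r + t * (H + H)) ≤ n →
                 suc (r + t * (H + H)) * suc (r + t * (H + H)) ≤ 4 * (suc H * suc H) * n
  square-bound H t r n r<2H fan k≤n = begin
    suc (r + t * (H + H)) * suc (r + t * (H + H))                      ≡⟨ expand H t r ⟩
    4 * H * (t * (t * H + r)) + 2 * (t * (H + H)) + suc r * suc r     ≤⟨ +-mono-≤ (+-mono-≤ (*-monoʳ-≤ (4 * H) fan)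
                                                                                            (*-monoʳ-≤ 2 2tH≤n))
                                                                                  (*-mono-≤ r<2H 1+r≤n) ⟩
    4 * H * n + 2 * n + (H + H) * n                                    ≤⟨ m≤m+n _ _ ⟩
    4 * H * n + 2 * n + (H + H) * n + (4 * (H * H) + 2 * H + 2) * n    ≡⟨ collect H n ⟩
    4 * (suc H * suc H) * n                                            ∎
    where
    open ≤-Reasoning
    2tH≤n : t * (H + H) ≤ n
    2tH≤n = ≤-trans (m≤n+m _ (suc r)) k≤n
    1+r≤n : suc r ≤ n
    1+r≤n = ≤-trans (s≤s (m≤m+n r _)) k≤n
    expand : ∀ H t r → suc (r + t * (H + H)) * suc (r + t * (H + H)) ≡
                       4 * H * (t * (t * H + r)) + 2 * (t * (H + H)) + suc r * suc r
    expand = solve-∀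
    collect : ∀ H n → 4 * H * n + 2 * n + (H + H) * n + (4 * (H * H) + 2 * H + 2) * n ≡
                      4 * (suc H * suc H) * n
    collect = solve-∀

  min-outdegree-bound : ∀ {n} L {k} (D : Digraph n) → 0 < n → CℓℓFree (suc (suc L)) D → MinOut≥ D k →
                        k * k ≤ 4 * (suc (suc L) * suc (suc L)) * n
  min-outdegree-bound L {zero} D _ _ _ = z≤n
  min-outdegree-bound {suc n′} L {suc k′} D _ free deg =
    subst (λ k → suc k * suc k ≤ 4 * (suc H * suc H) * n) (sym k′≡r+2tH)
      (square-bound H t r n (m%n<n k′ (H + H)) fan (subst (λ k → suc k ≤ n) k′≡r+2tH k≤n))
    where
    n H t r : ℕ
    n = suc n′
    H = suc L
    t = k′ / (H + H)
    r = k′ % (H + H)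
    k′≡r+2tH : k′ ≡ r + t * (H + H)
    k′≡r+2tH = m≡m%n+[m/n]*n k′ (H + H)
    tH<k : t * H < suc k′
    tH<k = s≤s (≤-trans (*-monoʳ-≤ t (m≤m+n H H)) (m/n*n≤m k′ (H + H)))
    open GreedyFan D zero L deg using (module Fan)
    open Fan t tH<k using (fan-bound)
    k≤n : suc k′ ≤ n
    k≤n = ≤-trans (subst (suc k′ ≤_) (outdeg≡count D zero) (deg zero)) (count≤n (arc D zero))
    excess : k′ ∸ t * H ≡ t * H + r
    excess = begin
      k′ ∸ t * H                      ≡⟨ cong (_∸ t * H) (trans k′≡r+2tH (regroup r t H)) ⟩
      t * H + (t * H + r) ∸ t * H     ≡⟨ m+n∸m≡n (t * H) _ ⟩
      t * H + r                       ∎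
      where
      open ≡-Reasoning
      regroup : ∀ r t H → r + t * (H + H) ≡ t * H + (t * H + r)
      regroup = solve-∀
    fan : t * (t * H + r) ≤ n
    fan = subst (λ e → t * e ≤ n) excess (fan-bound free)

  m⁺-upper : ∀ L {n k} → 0 < n → IsMPlus (suc (suc L)) n k →
             k * k ≤ 4 * (suc (suc L) * suc (suc L)) * n
  m⁺-upper L 0<n ((D , free , deg) , _) = min-outdegree-bound L D 0<n free deg

module Congruence where

  open import Data.Nat
  open import Data.Nat.Coprimality using (Coprime; coprime-+; 1-coprimeTo; coprime-divisor)
  open import Data.Nat.DivMod
  open import Data.Nat.Divisibility using (_∣_; divides; *-cancelʳ-∣)
  open import Data.Nat.Properties
  open import Data.Nat.Tactic.RingSolver using (solve-∀)
  open import Data.Product using (_×_; _,_)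
  open import Data.Sum using (inj₁; inj₂)
  open import Relation.Binary.PropositionalEquality
  open import Relation.Nullary using (contradiction)

  module _ (M : ℕ) .{{_ : NonZero M}} where

    %-cong-+ʳ : ∀ {a b} c → a % M ≡ b % M → (a + c) % M ≡ (b + c) % M
    %-cong-+ʳ {a} {b} c a≡b = begin
      (a + c) % M              ≡⟨ %-distribˡ-+ a c M ⟩
      (a % M + c % M) % M      ≡⟨ cong (λ r → (r + c % M) % M) a≡b ⟩
      (b % M + c % M) % M      ≡⟨ %-distribˡ-+ b c M ⟨
      (b + c) % M              ∎
      where open ≡-Reasoning

    %-cong-suc : ∀ {a b} → a % M ≡ b % M → suc a % M ≡ suc b % M
    %-cong-suc {a} {b} a≡b = begin
      suc a % M       ≡⟨ cong (_% M) (+-comm 1 a) ⟩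
      (a + 1) % M     ≡⟨ %-cong-+ʳ 1 a≡b ⟩
      (b + 1) % M     ≡⟨ cong (_% M) (+-comm b 1) ⟩
      suc b % M       ∎
      where open ≡-Reasoning

    %-cancel-+ʳ : ∀ {a b} c → (a + c) % M ≡ (b + c) % M → a % M ≡ b % M
    %-cancel-+ʳ {a} {b} c a+c≡b+c = begin
      a % M                        ≡⟨ wrap a ⟨
      (a + c + c * pred M) % M     ≡⟨ %-cong-+ʳ (c * pred M) a+c≡b+c ⟩
      (b + c + c * pred M) % M     ≡⟨ wrap b ⟩
      b % M                        ∎
      where
      open ≡-Reasoning
      wrap : ∀ x → (x + c + c * pred M) % M ≡ x % M
      wrap x = begin
        (x + c + c * pred M) % M    ≡⟨ cong (_% M) (+-assoc x c _) ⟩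
        (x + (c + c * pred M)) % M  ≡⟨ cong (λ y → (x + y) % M) (sym (*-suc c (pred M))) ⟩
        (x + c * suc (pred M)) % M  ≡⟨ cong (λ y → (x + c * y) % M) (suc-pred M) ⟩
        (x + c * M) % M             ≡⟨ [m+kn]%n≡m%n x c M ⟩
        x % M                       ∎

    %-≡⇒∣∸ : ∀ {a b} → a % M ≡ b % M → a ≤ b → M ∣ b ∸ a
    %-≡⇒∣∸ {a} {b} a≡b a≤b = divides (b / M ∸ a / M) (begin
      b ∸ a                                         ≡⟨ cong₂ _∸_ (m≡m%n+[m/n]*n b M) (m≡m%n+[m/n]*n a M) ⟩
      (b % M + b / M * M) ∸ (a % M + a / M * M)     ≡⟨ cong (λ r → (b % M + b / M * M) ∸ (r + a / M * M)) a≡b ⟩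
      (b % M + b / M * M) ∸ (b % M + a / M * M)     ≡⟨ [m+n]∸[m+o]≡n∸o (b % M) _ _ ⟩
      b / M * M ∸ a / M * M                         ≡⟨ *-distribʳ-∸ M (b / M) (a / M) ⟨
      (b / M ∸ a / M) * M                           ∎)
      where open ≡-Reasoning

  %-≡-∣ : ∀ {m M a b} .{{_ : NonZero m}} .{{_ : NonZero M}} → m ∣ M → a % M ≡ b % M → a % m ≡ b % m
  %-≡-∣ {m} {M} {a} {b} m∣M a≡b = begin
    a % m        ≡⟨ m∣n⇒o%n%m≡o%m m M a m∣M ⟨
    a % M % m    ≡⟨ cong (_% m) a≡b ⟩
    b % M % m    ≡⟨ m∣n⇒o%n%m≡o%m m M b m∣M ⟩
    b % m        ∎
    where open ≡-Reasoning

  module _ (X : ℕ → ℕ) (M : ℕ) .{{_ : NonZero M}} where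

    Advances : ℕ → ℕ → Set
    Advances i j = ∀ s → i ≤ s → s < j → X (suc s) % M ≡ suc (X s) % M

    walk : ∀ i d → Advances i (i + d) → X (i + d) % M ≡ (X i + d) % M
    walk i zero    _   = cong (_% M) (trans (cong X (+-identityʳ i)) (sym (+-identityʳ (X i))))
    walk i (suc d) adv = begin
      X (i + suc d) % M     ≡⟨ cong (λ c → X c % M) (+-suc i d) ⟩
      X (suc (i + d)) % M   ≡⟨ adv (i + d) (m≤m+n i d) i+d<i+1+d ⟩
      suc (X (i + d)) % M   ≡⟨ %-cong-suc M (walk i d (λ s i≤s s<i+d → adv s i≤s (<-trans s<i+d i+d<i+1+d))) ⟩
      suc (X i + d) % M     ≡⟨ cong (_% M) (sym (+-suc (X i) d)) ⟩
      (X i + suc d) % M     ∎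
      where
      open ≡-Reasoning
      i+d<i+1+d : i + d < i + suc d
      i+d<i+1+d = +-monoʳ-< i (n<1+n d)

  coprime-suc : ∀ K → Coprime (suc K) K
  coprime-suc K = subst (λ a → Coprime a K) (+-comm K 1) (coprime-+ (1-coprimeTo K))

  ∣-cofactor : ∀ {m K e} .{{_ : NonZero m}} → m * suc K ∣ e * (m * K) → suc K ∣ e
  ∣-cofactor {m} {K} {e} m[K+1]∣emK =
    coprime-divisor (coprime-suc K)
      (*-cancelʳ-∣ m (subst₂ _∣_ (*-comm m (suc K)) (swap e K m) m[K+1]∣emK))
    where
    swap : ∀ e K m → e * (m * K) ≡ K * e * m
    swap = solve-∀

  ∣-consecutive : ∀ {m K d} .{{_ : NonZero m}} → m * K ∣ d → m * suc K ∣ d → m * K * suc K ∣ d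
  ∣-consecutive {m} {K} (divides e refl) m[K+1]∣d with divides f refl ← ∣-cofactor {m} {K} {e} m[K+1]∣d
    = divides f (regroup f K m)
    where
    regroup : ∀ f K m → f * suc K * (m * K) ≡ f * (m * K * suc K)
    regroup = solve-∀

  ∣∧<⇒≡0 : ∀ {M d} → M ∣ d → d < M → d ≡ 0
  ∣∧<⇒≡0     (divides zero    refl) _   = refl
  ∣∧<⇒≡0 {M} (divides (suc q) refl) d<M = contradiction d<M (≤⇒≯ (m≤m+n M (q * M)))

  module _ {m K : ℕ} .{{_ : NonZero m}} .{{_ : NonZero K}} where

    private instance
      mK≢0 : NonZero (m * K)
      mK≢0 = m*n≢0 m K
      m[K+1]≢0 : NonZero (m * suc K)
      m[K+1]≢0 = m*n≢0 m (suc K)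

    crt-≤ : ∀ {a b} → a % (m * K) ≡ b % (m * K) → a % (m * suc K) ≡ b % (m * suc K) →
            a ≤ b → b < m * K * suc K → a ≡ b
    crt-≤ {a} {b} ≡mod₁ ≡mod₂ a≤b b<mK[K+1] =
      ≤-antisym a≤b (m∸n≡0⇒m≤n (∣∧<⇒≡0 mK[K+1]∣b∸a (≤-<-trans (m∸n≤m b a) b<mK[K+1])))
      where
      mK[K+1]∣b∸a : m * K * suc K ∣ b ∸ a
      mK[K+1]∣b∸a = ∣-consecutive (%-≡⇒∣∸ (m * K) ≡mod₁ a≤b) (%-≡⇒∣∸ (m * suc K) ≡mod₂ a≤b)

    crt : ∀ {a b} → a % (m * K) ≡ b % (m * K) → a % (m * suc K) ≡ b % (m * suc K) →
          a < m * K * suc K → b < m * K * suc K → a ≡ b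
    crt {a} {b} ≡mod₁ ≡mod₂ a< b< with ≤-total a b
    ... | inj₁ a≤b = crt-≤ ≡mod₁ ≡mod₂ a≤b b<
    ... | inj₂ b≤a = sym (crt-≤ (sym ≡mod₁) (sym ≡mod₂) b≤a a<)

  module _ (P Q : ℕ → ℕ) {A B : ℕ} .{{_ : NonZero A}} .{{_ : NonZero B}} where

    walks-meet : ∀ {j ℓ} → j ≤ ℓ →
                 Advances P A 0 j → Advances Q A 0 j → Advances P B j ℓ → Advances Q B j ℓ →
                 P 0 ≡ Q 0 → P ℓ ≡ Q ℓ → P j % A ≡ Q j % A × P j % B ≡ Q j % B
    walks-meet {j} {ℓ} j≤ℓ advPA advQA advPB advQB P0≡Q0 Pℓ≡Qℓ =
      trans (walk P A 0 j advPA) (trans (cong (λ x → (x + j) % A) P0≡Q0) (sym (walk Q A 0 j advQA))) ,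
      %-cancel-+ʳ B d (begin
        (P j + d) % B   ≡⟨ walk P B j d (subst (Advances P B j) (sym j+d≡ℓ) advPB) ⟨
        P (j + d) % B   ≡⟨ cong (λ i → P i % B) j+d≡ℓ ⟩
        P ℓ % B         ≡⟨ cong (_% B) Pℓ≡Qℓ ⟩
        Q ℓ % B         ≡⟨ cong (λ i → Q i % B) j+d≡ℓ ⟨
        Q (j + d) % B   ≡⟨ walk Q B j d (subst (Advances Q B j) (sym j+d≡ℓ) advQB) ⟩
        (Q j + d) % B   ∎)
      where
      open ≡-Reasoning
      d : ℕ
      d = ℓ ∸ j
      j+d≡ℓ : j + d ≡ ℓ
      j+d≡ℓ = m+[n∸m]≡n j≤ℓ

module Construction where

  open import Data.Bool using (Bool; true; false; not)
  open import Data.Fin using (Fin; zero; suc; toℕ; fromℕ; fromℕ<; inject₁)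
  open import Data.Fin.Properties using (toℕ-injective; toℕ<n; toℕ-fromℕ<; toℕ-inject₁; toℕ-fromℕ)
  open import Data.Nat
  open import Data.Nat.DivMod
  open import Data.Nat.Divisibility using (m∣m*n)
  open import Data.Nat.Properties
  open import Data.Product using (_×_; _,_; proj₁; proj₂)
  open import Data.Sum using (_⊎_; inj₁; inj₂)
  open import Function using (_∘_)
  open import Relation.Binary.PropositionalEquality
  open import Relation.Nullary using (¬_; Dec; does; yes; no)
  open import Relation.Nullary.Decidable using (dec-true; dec-false)

  open import Defs
  open Counting
  open Congruence

  does⇒ : ∀ {p} {P : Set p} (P? : Dec P) → does P? ≡ true → P
  does⇒ (yes p) _  = p
  does⇒ (no _)  ()

  clamp : ∀ {N} → ℕ → Fin (suc N)
  clamp {N} s = fromℕ< (s≤s (m⊓n≤n s N))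

  toℕ-clamp : ∀ {N s} → s ≤ N → toℕ (clamp {N} s) ≡ s
  toℕ-clamp {N} {s} s≤N = trans (toℕ-fromℕ< _) (m≤n⇒m⊓n≡m s≤N)

  clamp-toℕ : ∀ {N} (f : Fin (suc N)) → clamp (toℕ f) ≡ f
  clamp-toℕ f = toℕ-injective (toℕ-clamp (s≤s⁻¹ (toℕ<n f)))

  <∸⇒+< : ∀ {a b s} → a ≤ b → s < b ∸ a → a + s < b
  <∸⇒+< {a} {b} {s} a≤b s<b∸a = subst (_≤ b) (cong suc (+-comm s a)) (m≤o∸n⇒m+n≤o (suc s) a≤b s<b∸a)

  ∸≤⇒≤+ : ∀ {a b s} → b ∸ a ≤ s → b ≤ a + s
  ∸≤⇒≤+ {a} {b} b∸a≤s = ≤-trans (m≤n+m∸n b a) (+-monoʳ-≤ a b∸a≤s)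

  module _ (L K : ℕ) where

    H : ℕ
    H = suc L

    m : ℕ
    m = H + H

    modulus : Bool → ℕ
    modulus b = m * suc (𝟙 b + K)

    firstHalf : ℕ → Bool
    firstHalf U = does (U % m <? H)

    modulusOf : ℕ → ℕ
    modulusOf U = modulus (firstHalf U)

    arcℕ : ℕ → ℕ → Bool
    arcℕ U V = does (V % modulusOf U ≟ suc U % modulusOf U)

    no-loop : ∀ U → arcℕ U U ≡ false
    no-loop U = dec-false (U % modulusOf U ≟ suc U % modulusOf U) λ U≡U+1 →
      0≢1+n (trans (%-cancel-+ʳ (modulusOf U) {0} {1} U U≡U+1) (m<n⇒m%n≡m 1<modulusOf))
      where
      1<modulusOf : 1 < modulusOf U
      1<modulusOf = ≤-trans (s≤s (≤-trans (s≤s z≤n) (m≤n+m H L))) (m≤m*n m (suc (𝟙 (firstHalf U) + K)))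

    G : ∀ n → Digraph n
    G n = record { arc = λ u v → arcℕ (toℕ u) (toℕ v) ; noLoop = no-loop ∘ toℕ }

    arc-step : ∀ {U V} → arcℕ U V ≡ true → V % modulusOf U ≡ suc U % modulusOf U
    arc-step {U} {V} = does⇒ (V % modulusOf U ≟ suc U % modulusOf U)

    arc-phase : ∀ {U V} → arcℕ U V ≡ true → V % m ≡ suc U % m
    arc-phase {U} {V} U→V =
      %-≡-∣ {m} {modulusOf U} {V} {suc U} (m∣m*n (suc (𝟙 (firstHalf U) + K))) (arc-step {U} {V} U→V)

    half-true : ∀ U → U % m < H → firstHalf U ≡ true
    half-true U = dec-true (U % m <? H)

    half-false : ∀ U → H ≤ U % m → firstHalf U ≡ false
    half-false U H≤ = dec-false (U % m <? H) (≤⇒≯ H≤)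

    phase-+ : ∀ c s → (c + s) % m ≡ (c % m + s) % m
    phase-+ c s = %-cong-+ʳ m {c} {c % m} s (sym (m%n%n≡m%n c m))

    phase-below : ∀ c {s} → c % m + s < m → (c + s) % m ≡ c % m + s
    phase-below c {s} r+s<m = trans (phase-+ c s) (m<n⇒m%n≡m r+s<m)

    half-below : ∀ c {s} → c % m + s < H → firstHalf (c + s) ≡ true
    half-below c {s} r+s<H =
      half-true (c + s) (subst (_< H) (sym (phase-below c (<-≤-trans r+s<H (m≤m+n H H)))) r+s<H)

    half-above : ∀ c {s} → H ≤ c % m + s → c % m + s < m → firstHalf (c + s) ≡ false
    half-above c {s} H≤r+s r+s<m = half-false (c + s) (subst (H ≤_) (sym (phase-below c r+s<m)) H≤r+s)

    half-wrapped : ∀ c {s} → m ≤ c % m + s → c % m + s < m + H → firstHalf (c + s) ≡ true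
    half-wrapped c {s} m≤r+s r+s<m+H = half-true (c + s) (subst (_< H) (sym c+s%m≡) r+s∸m<H)
      where
      r+s∸m<H : c % m + s ∸ m < H
      r+s∸m<H = m<n+o⇒m∸n<o (c % m + s) m r+s<m+H
      c+s%m≡ : (c + s) % m ≡ c % m + s ∸ m
      c+s%m≡ = trans (phase-+ c s) (trans (sym (m≤n⇒[n∸m]%m≡n%m m≤r+s)) (m<n⇒m%n≡m (<-≤-trans r+s∸m<H (m≤m+n H H))))

    record Switch (c : ℕ) : Set where
      field
        j      : ℕ
        1≤j    : 1 ≤ j
        j≤H    : j ≤ H
        before : ∀ s → s < j → firstHalf (c + s) ≡ firstHalf c
        after  : ∀ s → j ≤ s → s ≤ H → firstHalf (c + s) ≡ not (firstHalf c)

    switch : ∀ c → Switch c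
    switch c with c % m <? H
    ... | yes r<H = record
      { j      = H ∸ r
      ; 1≤j    = m<n⇒0<n∸m r<H
      ; j≤H    = m∸n≤m H r
      ; before = λ s s<j → trans (half-below c (<∸⇒+< (<⇒≤ r<H) s<j)) (sym (half-true c r<H))
      ; after  = λ s j≤s s≤H → trans (half-above c (∸≤⇒≤+ j≤s) (+-mono-<-≤ r<H s≤H)) (cong not (sym (half-true c r<H)))
      }
      where
      r : ℕ
      r = c % m
    ... | no r≮H = record
      { j      = m ∸ r
      ; 1≤j    = m<n⇒0<n∸m r<m
      ; j≤H    = ≤-trans (∸-monoʳ-≤ m H≤r) (≤-reflexive (m+n∸m≡n H H))
      ; before = λ s s<j → trans (half-above c (≤-trans H≤r (m≤m+n r s)) (<∸⇒+< (<⇒≤ r<m) s<j)) (sym (half-false c H≤r))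
      ; after  = λ s j≤s s≤H → trans (half-wrapped c (∸≤⇒≤+ j≤s) (+-mono-<-≤ r<m s≤H)) (cong not (sym (half-false c H≤r)))
      }
      where
      r : ℕ
      r = c % m
      r<m : r < m
      r<m = m%n<n c m
      H≤r : H ≤ r
      H≤r = ≮⇒≥ r≮H

    module _ {n} (p : Fin (suc (suc H)) → Fin n)
             (arcs : ∀ (i : Fin (suc H)) → arc (G n) (p (inject₁ i)) (p (suc i)) ≡ true) where

      -- p read as a sequence of numbers indexed by ℕ, constant beyond index ℓ
      trace : ℕ → ℕ
      trace s = toℕ (p (clamp s))

      trace-toℕ : ∀ f → trace (toℕ f) ≡ toℕ (p f)
      trace-toℕ f = cong (toℕ ∘ p) (clamp-toℕ f)

      trace-arc : ∀ s → s < suc H → arcℕ (trace s) (trace (suc s)) ≡ true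
      trace-arc s s<ℓ = begin
        arcℕ (trace s) (trace (suc s))                 ≡⟨ cong₂ arcℕ (trans (cong trace s≡) (trace-toℕ (inject₁ i)))
                                                                     (trans (cong (trace ∘ suc) s≡i) (trace-toℕ (suc i))) ⟩
        arcℕ (toℕ (p (inject₁ i))) (toℕ (p (suc i)))   ≡⟨ arcs i ⟩
        true                                           ∎
        where
        open ≡-Reasoning
        i : Fin (suc H)
        i = fromℕ< s<ℓ
        s≡i : s ≡ toℕ i
        s≡i = sym (toℕ-fromℕ< s<ℓ)
        s≡ : s ≡ toℕ (inject₁ i)
        s≡ = trans s≡i (sym (toℕ-inject₁ i))

      trace-half : ∀ s → s ≤ suc H → firstHalf (trace s) ≡ firstHalf (trace 0 + s)
      trace-half s s≤ℓ = cong (λ r → does (r <? H))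
        (walk trace m 0 s (λ s′ _ s′<s → arc-phase {trace s′} {trace (suc s′)} (trace-arc s′ (<-≤-trans s′<s s≤ℓ))))

      trace-advances : ∀ {c b i j} → trace 0 ≡ c → j ≤ suc H → (∀ s → i ≤ s → s < j → firstHalf (c + s) ≡ b) →
                       Advances trace (modulus b) i j
      trace-advances refl j≤ℓ half s i≤s s<j =
        subst (λ b → trace (suc s) % modulus b ≡ suc (trace s) % modulus b)
              (trans (trace-half s (<⇒≤ (<-≤-trans s<j j≤ℓ))) (half s i≤s s<j))
              (arc-step {trace s} {trace (suc s)} (trace-arc s (<-≤-trans s<j j≤ℓ)))

    modulus-crt : ∀ b {x y} → x % modulus b ≡ y % modulus b → x % modulus (not b) ≡ y % modulus (not b) →
                  x < m * suc K * suc (suc K) → y < m * suc K * suc (suc K) → x ≡ y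
    modulus-crt true  ≡hi ≡lo = crt {m} {suc K} ≡lo ≡hi
    modulus-crt false ≡lo ≡hi = crt {m} {suc K} ≡lo ≡hi

    cℓℓ-free : ∀ {n} → n ≤ m * suc K * suc (suc K) → CℓℓFree (suc H) (G n)
    cℓℓ-free {n} n≤ (p , q , _ , _ , p₀≡q₀ , pℓ≡qℓ , disjoint , arcs-p , arcs-q) =
      internal (disjoint (clamp j) (clamp j) (toℕ-injective pⱼ≡qⱼ))
      where
      P Q : ℕ → ℕ
      P = trace p arcs-p
      Q = trace q arcs-q
      c : ℕ
      c = P 0
      open Switch (switch c)
      b : Bool
      b = firstHalf c
      P₀≡Q₀ : P 0 ≡ Q 0
      P₀≡Q₀ = cong toℕ p₀≡q₀
      j≤ℓ : j ≤ suc H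
      j≤ℓ = m≤n⇒m≤1+n j≤H
      clamp-ℓ : clamp (suc H) ≡ fromℕ (suc H)
      clamp-ℓ = toℕ-injective (trans (toℕ-clamp ≤-refl) (sym (toℕ-fromℕ (suc H))))
      Pℓ≡Qℓ : P (suc H) ≡ Q (suc H)
      Pℓ≡Qℓ = cong toℕ (trans (cong p clamp-ℓ) (trans pℓ≡qℓ (cong q (sym clamp-ℓ))))
      bounded : (r : Fin (suc (suc H)) → Fin n) → toℕ (r (clamp j)) < m * suc K * suc (suc K)
      bounded r = <-≤-trans (toℕ<n (r (clamp j))) n≤
      before′ : ∀ s → 0 ≤ s → s < j → firstHalf (c + s) ≡ b
      before′ s _ = before s
      after′ : ∀ s → j ≤ s → s < suc H → firstHalf (c + s) ≡ not b
      after′ s j≤s s<ℓ = after s j≤s (s≤s⁻¹ s<ℓ)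
      meet : P j % modulus b ≡ Q j % modulus b × P j % modulus (not b) ≡ Q j % modulus (not b)
      meet = walks-meet P Q j≤ℓ
        (trace-advances p arcs-p refl j≤ℓ before′) (trace-advances q arcs-q (sym P₀≡Q₀) j≤ℓ before′)
        (trace-advances p arcs-p refl ≤-refl after′) (trace-advances q arcs-q (sym P₀≡Q₀) ≤-refl after′)
        P₀≡Q₀ Pℓ≡Qℓ
      pⱼ≡qⱼ : P j ≡ Q j
      pⱼ≡qⱼ = modulus-crt b (proj₁ meet) (proj₂ meet) (bounded p) (bounded q)
      internal : ¬ ((clamp j ≡ zero × clamp j ≡ zero) ⊎ (clamp j ≡ fromℕ (suc H) × clamp j ≡ fromℕ (suc H)))
      internal (inj₁ (j≡0 , _)) = >⇒≢ 1≤j (trans (sym (toℕ-clamp j≤ℓ)) (cong toℕ j≡0))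
      internal (inj₂ (j≡ℓ , _)) =
        <⇒≢ (s≤s j≤H) (trans (sym (toℕ-clamp j≤ℓ)) (trans (cong toℕ j≡ℓ) (toℕ-fromℕ (suc H))))

    modulus≤ : ∀ b → modulus b ≤ m * suc (suc K)
    modulus≤ true  = ≤-refl
    modulus≤ false = *-monoʳ-≤ m (n≤1+n (suc K))

    out-degree : ∀ {n} (u : Fin n) → n / (m * suc (suc K)) ≤ outdeg (G n) u
    out-degree {n} u = begin
      n / (m * suc (suc K))     ≤⟨ /-monoʳ-≤ n (modulus≤ (firstHalf U)) ⟩
      n / M                     ≤⟨ periodic-count successor M periodic (m%n<n (suc U) M) hit n ⟩
      count (arc (G n) u)       ≡⟨ outdeg≡count (G n) u ⟨
      outdeg (G n) u            ∎
      where
      open ≤-Reasoning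
      U M : ℕ
      U = toℕ u
      M = modulusOf U
      successor : ℕ → Bool
      successor x = does (x % M ≟ suc U % M)
      periodic : ∀ x → successor (M + x) ≡ successor x
      periodic x = cong (λ r → does (r ≟ suc U % M)) (trans (cong (_% M) (+-comm M x)) ([m+n]%n≡m%n x M))
      hit : successor (suc U % M) ≡ true
      hit = dec-true (suc U % M % M ≟ suc U % M) (m%n%n≡m%n (suc U) M)

    in-degree : ∀ {n} (v : Fin n) → n / (m * suc (suc K)) ≤ indeg (G n) v
    in-degree {n} v = begin
      n / (m * suc (suc K))            ≤⟨ /-monoʳ-≤ n (modulus≤ β) ⟩
      n / M                            ≤⟨ periodic-count predecessor M periodic (m%n<n (V + pred M) M) hit n ⟩
      count {n} (predecessor ∘ toℕ)    ≤⟨ count-mono {n} {predecessor ∘ toℕ} (predecessor⇒arc ∘ toℕ) ⟩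
      count (λ u → arc (G n) u v)      ≡⟨ indeg≡count (G n) v ⟨
      indeg (G n) v                    ∎
      where
      open ≤-Reasoning
      V : ℕ
      V = toℕ v
      -- the in-neighbours of V are in the phase just before that of V
      β : Bool
      β = firstHalf (V + pred m)
      M : ℕ
      M = modulus β
      predecessor : ℕ → Bool
      predecessor x = does (suc x % M ≟ V % M)
      periodic : ∀ x → predecessor (M + x) ≡ predecessor x
      periodic x = cong (λ r → does (r ≟ V % M))
        (trans (cong (_% M) (trans (sym (+-suc M x)) (+-comm M (suc x)))) ([m+n]%n≡m%n (suc x) M))
      hit : predecessor ((V + pred M) % M) ≡ true
      hit = dec-true (suc ((V + pred M) % M) % M ≟ V % M) (begin-equality
        suc ((V + pred M) % M) % M    ≡⟨ %-cong-suc M (m%n%n≡m%n (V + pred M) M) ⟩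
        suc (V + pred M) % M          ≡⟨ cong (_% M) (sym (+-suc V (pred M))) ⟩
        (V + M) % M                   ≡⟨ [m+n]%n≡m%n V M ⟩
        V % M                         ∎)
      predecessor⇒arc : ∀ x → predecessor x ≡ true → arcℕ x V ≡ true
      predecessor⇒arc x pred-x = subst (λ b → does (V % modulus b ≟ suc x % modulus b) ≡ true)
                                       (sym same-half) (dec-true (V % M ≟ suc x % M) (sym x+1≡V))
        where
        x+1≡V : suc x % M ≡ V % M
        x+1≡V = does⇒ (suc x % M ≟ V % M) pred-x
        same-half : firstHalf x ≡ β
        same-half = cong (λ r → does (r <? H)) (%-cancel-+ʳ m {x} {V + pred m} 1 (begin-equality
          (x + 1) % m          ≡⟨ cong (_% m) (+-comm x 1) ⟩
          suc x % m            ≡⟨ %-≡-∣ {m} {M} {suc x} {V} (m∣m*n (suc (𝟙 β + K))) x+1≡V ⟩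
          V % m                ≡⟨ [m+n]%n≡m%n V m ⟨
          (V + m) % m          ≡⟨ cong (_% m) (trans (+-assoc V (pred m) 1) (cong (V +_) (+-comm (pred m) 1))) ⟨
          (V + pred m + 1) % m ∎))

module LowerBound where

  open import Data.Nat
  open import Data.Nat.DivMod using (_/_; m*n/n≡m; /-monoˡ-≤)
  open import Data.Nat.Properties
  open import Data.Nat.Tactic.RingSolver using (solve-∀)
  open import Data.Product using (∃; _×_; _,_)
  open import Data.Sum using (inj₁; inj₂)
  open import Relation.Binary.PropositionalEquality
  open import Relation.Nullary using (yes; no; contradiction)

  open import Defs
  open Construction using (G; cℓℓ-free; out-degree; in-degree)

  bracket : ∀ m .{{_ : NonZero m}} n → ∃ λ K → m * K * suc K ≤ n × n ≤ m * suc K * suc (suc K)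
  bracket m zero = 0 , ≤-reflexive (cong (_* 1) (*-zeroʳ m)) , z≤n
  bracket m (suc n) with bracket m n
  ... | K , lower , upper with suc n ≤? m * suc K * suc (suc K)
  ...   | yes fits = K , m≤n⇒m≤1+n lower , fits
  ...   | no  n≮  = suc K , m≤n⇒m≤1+n (s≤s⁻¹ (≰⇒> n≮)) ,
                    ≤-trans (s≤s upper) (*-mono-< (*-monoʳ-< m (n<1+n (suc K))) (n<1+n (suc (suc K))))

  *≤⇒≤/ : ∀ {a n} M .{{_ : NonZero M}} → a * M ≤ n → a ≤ n / M
  *≤⇒≤/ {a} {n} M aM≤n = subst (_≤ n / M) (m*n/n≡m a M) (/-monoˡ-≤ M aM≤n)

  quadratic-gap : ∀ d {i} → 6 + 5 * d ≤ i → d * ((2 + i) * (3 + i)) ≤ suc d * (i * i)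
  quadratic-gap d {i} 6+5d≤i =
    subst (λ i → d * ((2 + i) * (3 + i)) ≤ suc d * (i * i)) (m+[n∸m]≡n 6+5d≤i)
          (≤-trans (m≤m+n _ _) (≤-reflexive (sym (expand d (i ∸ (6 + 5 * d))))))
    where
    -- with i = 6 + 5d + r, the gap (d + 1) i² − d (i + 2)(i + 3) = i (i − 5d) − 6d is 6 (6 + 4d + r) + i r
    expand : ∀ d r → suc d * ((6 + 5 * d + r) * (6 + 5 * d + r)) ≡
                     d * ((2 + (6 + 5 * d + r)) * (3 + (6 + 5 * d + r))) +
                     (6 * (6 + 4 * d + r) + (6 + 5 * d + r) * r)
    expand = solve-∀

  module _ (L : ℕ) where

    m : ℕ
    m = suc L + suc L

    semidegree-square-bound : ∀ d {K n k} → 7 + 5 * d ≤ K → m * K * suc K ≤ n → n ≤ m * suc K * suc (suc K) →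
                              n / (m * suc (suc K)) ≤ k → d * n ≤ suc d * (m * (k * k))
    semidegree-square-bound d {suc i} {n} {k} (s≤s 6+5d≤i) lower upper n/M≤k = begin
      d * n                                   ≤⟨ *-monoʳ-≤ d upper ⟩
      d * (m * (2 + i) * (3 + i))             ≡⟨ regroup d m i ⟩
      m * (d * ((2 + i) * (3 + i)))           ≤⟨ *-monoʳ-≤ m (quadratic-gap d 6+5d≤i) ⟩
      m * (suc d * (i * i))                   ≤⟨ *-monoʳ-≤ m (*-monoʳ-≤ (suc d) (*-mono-≤ i≤k i≤k)) ⟩
      m * (suc d * (k * k))                   ≡⟨ *-comm-middle m (suc d) (k * k) ⟩
      suc d * (m * (k * k))                   ∎
      where
      open ≤-Reasoning
      M : ℕ
      M = m * (3 + i)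
      regroup : ∀ d m i → d * (m * (2 + i) * (3 + i)) ≡ m * (d * ((2 + i) * (3 + i)))
      regroup = solve-∀
      *-comm-middle : ∀ a b c → a * (b * c) ≡ b * (a * c)
      *-comm-middle = solve-∀
      expand : ∀ m i → i * (m * (3 + i)) + 2 * m ≡ m * (1 + i) * (2 + i)
      expand = solve-∀
      i≤k : i ≤ k
      i≤k = ≤-trans (*≤⇒≤/ M (≤-trans (m≤m+n (i * M) (2 * m)) (≤-trans (≤-reflexive (expand m i)) lower))) n/M≤k

    threshold : ℕ → ℕ
    threshold d = suc (m * (7 + 5 * d) * (8 + 5 * d))

    m⁰-≥-quotient : ∀ K {n k} → n ≤ m * suc K * suc (suc K) → IsMZero (suc (suc L)) n k →
                    n / (m * suc (suc K)) ≤ k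
    m⁰-≥-quotient K {n} {k} upper (_ , bounded) = below (bounded (G L K n) (cℓℓ-free L K upper))
      where
      below : MinSemi≤ (G L K n) k → n / (m * suc (suc K)) ≤ k
      below (v , inj₁ out≤k) = ≤-trans (out-degree L K v) out≤k
      below (v , inj₂ in≤k)  = ≤-trans (in-degree L K v) in≤k

    2ℓ∸2≡m : 2 * suc (suc L) ∸ 2 ≡ m
    2ℓ∸2≡m = trans (+-suc L (suc (L + 0))) (cong (λ x → suc (L + suc x)) (+-identityʳ L))

    m⁰-lower : ∀ d {n k} → threshold d ≤ n → IsMZero (suc (suc L)) n k →
               d * n ≤ suc d * ((2 * suc (suc L) ∸ 2) * (k * k))
    m⁰-lower d {n} {k} N≤n m⁰ with bracket m n
    ... | K , lower , upper with 7 + 5 * d ≤? K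
    ...   | yes large = subst (λ c → d * n ≤ suc d * (c * (k * k))) (sym 2ℓ∸2≡m)
                              (semidegree-square-bound d large lower upper (m⁰-≥-quotient K upper m⁰))
    ...   | no  small = contradiction N≤n (<⇒≱ (s≤s (≤-trans upper (*-mono-≤ (*-monoʳ-≤ m K<7+5d) (s≤s K<7+5d)))))
      where
      K<7+5d : K < 7 + 5 * d
      K<7+5d = ≰⇒> small

module RationalBounds where

  open import Data.Integer as ℤ using (ℤ; +_)
  import Data.Integer.Properties as ℤ
  open import Data.Integer.Tactic.RingSolver using (solve-∀)
  open import Data.Nat as ℕ using (ℕ; suc)
  import Data.Nat.Properties as ℕ
  import Data.Nat.Tactic.RingSolver as ℕ-Solver
  import Data.Nat.Coprimality as Coprimality
  open import Data.Rational
  open import Data.Rational.Properties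
    using (↥p/↧p≡p; toℚᵘ-cancel-≤; toℚᵘ-homo-*; toℚᵘ-homo-+; toℚᵘ-homo‿-; drop-*<*)
  open import Data.Rational.Unnormalised as ℚᵘ using (ℚᵘ; mkℚᵘ; *≤*)
  import Data.Rational.Unnormalised.Properties as ℚᵘ
  open import Relation.Binary.PropositionalEquality

  open import Defs

  toℚᵘ-ℕ→ℚ : ∀ a → toℚᵘ (ℕ→ℚ a) ≡ mkℚᵘ (+ a) 0
  toℚᵘ-ℕ→ℚ a = cong toℚᵘ (↥p/↧p≡p (mkℚ (+ a) 0 (Coprimality.sym (Coprimality.1-coprimeTo a))))

  positive⇒1≤numerator : ∀ {ε} → 0ℚ < ε → + 1 ℤ.≤ ↥ ε
  positive⇒1≤numerator {mkℚ z _ _} 0<ε with subst (+ 0 ℤ.<_) (ℤ.*-identityʳ z) (drop-*<* 0<ε)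
  ... | ℤ.+<+ 0<z = ℤ.+≤+ 0<z

  module _ {z : ℤ} {d a b : ℕ} where

    one-minus-≤ᵘ : + 1 ℤ.≤ z → d ℕ.* a ℕ.≤ suc d ℕ.* b →
                   (ℚᵘ.1ℚᵘ ℚᵘ.- mkℚᵘ z d) ℚᵘ.* mkℚᵘ (+ a) 0 ℚᵘ.≤ mkℚᵘ (+ b) 0
    one-minus-≤ᵘ 1≤z da≤[d+1]b = *≤* (begin
      ((+ 1 ℤ.* + suc d ℤ.+ ℤ.- z ℤ.* + 1) ℤ.* + a) ℤ.* + 1   ≡⟨ normalise (+ suc d) z (+ a) ⟩
      (+ suc d ℤ.- z) ℤ.* + a                                 ≤⟨ ℤ.*-monoʳ-≤-nonNeg (+ a) (ℤ.+-monoʳ-≤ (+ suc d)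
                                                                                               (ℤ.neg-mono-≤ 1≤z)) ⟩
      (+ suc d ℤ.- + 1) ℤ.* + a                               ≡⟨ ℤ.pos-* d a ⟨
      + (d ℕ.* a)                                             ≤⟨ ℤ.+≤+ da≤[d+1]b ⟩
      + (suc d ℕ.* b)                                         ≡⟨ cong +_ (ℕ-comm d b) ⟩
      + (b ℕ.* (1 ℕ.* suc d ℕ.* 1))                           ≡⟨ ℤ.pos-* b _ ⟩
      + b ℤ.* + (1 ℕ.* suc d ℕ.* 1)                           ∎)
      where
      open ℤ.≤-Reasoning
      normalise : ∀ D Z A → ((+ 1 ℤ.* D ℤ.+ ℤ.- Z ℤ.* + 1) ℤ.* A) ℤ.* + 1 ≡ (D ℤ.- Z) ℤ.* A
      normalise = solve-∀
      ℕ-comm : ∀ d b → suc d ℕ.* b ≡ b ℕ.* (1 ℕ.* suc d ℕ.* 1)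
      ℕ-comm = ℕ-Solver.solve-∀

    plus-ε-≤ᵘ : + 0 ℤ.≤ z → ∀ c → a ℕ.≤ c ℕ.* b →
                mkℚᵘ (+ a) 0 ℚᵘ.≤ (mkℚᵘ (+ c) 0 ℚᵘ.+ mkℚᵘ z d) ℚᵘ.* mkℚᵘ (+ b) 0
    plus-ε-≤ᵘ 0≤z c a≤cb = *≤* (begin
      + a ℤ.* + (1 ℕ.* suc d ℕ.* 1)                          ≡⟨ ℤ.pos-* a _ ⟨
      + (a ℕ.* (1 ℕ.* suc d ℕ.* 1))                          ≤⟨ ℤ.+≤+ (ℕ.*-monoˡ-≤ (1 ℕ.* suc d ℕ.* 1) a≤cb) ⟩
      + (c ℕ.* b ℕ.* (1 ℕ.* suc d ℕ.* 1))                    ≡⟨ cong +_ (ℕ-regroup c b d) ⟩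
      + (c ℕ.* suc d ℕ.* b)                                  ≡⟨ trans (ℤ.pos-* (c ℕ.* suc d) b) (cong (ℤ._* + b) (ℤ.pos-* c (suc d))) ⟩
      + c ℤ.* + suc d ℤ.* + b                                ≤⟨ ℤ.*-monoʳ-≤-nonNeg (+ b) (x≤x+z (+ c ℤ.* + suc d)) ⟩
      (+ c ℤ.* + suc d ℤ.+ z) ℤ.* + b                        ≡⟨ normalise (+ c ℤ.* + suc d) z (+ b) ⟩
      ((+ c ℤ.* + suc d ℤ.+ z ℤ.* + 1) ℤ.* + b) ℤ.* + 1      ∎)
      where
      open ℤ.≤-Reasoning
      x≤x+z : ∀ x → x ℤ.≤ x ℤ.+ z
      x≤x+z x = subst (ℤ._≤ x ℤ.+ z) (ℤ.+-identityʳ x) (ℤ.+-monoʳ-≤ x 0≤z)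
      ℕ-regroup : ∀ c b d → c ℕ.* b ℕ.* (1 ℕ.* suc d ℕ.* 1) ≡ c ℕ.* suc d ℕ.* b
      ℕ-regroup = ℕ-Solver.solve-∀
      normalise : ∀ X Z B → (X ℤ.+ Z) ℤ.* B ≡ ((X ℤ.+ Z ℤ.* + 1) ℤ.* B) ℤ.* + 1
      normalise = solve-∀

  -- ε = z / (d + 1) with z ≥ 1, so ε ≥ 1 / (d + 1) and (1 − ε) a ≤ d a / (d + 1)
  one-minus-ε-≤ : ∀ ε → 0ℚ < ε → ∀ {a b} → ℚ.denominator-1 ε ℕ.* a ℕ.≤ suc (ℚ.denominator-1 ε) ℕ.* b →
                  (1ℚ - ε) * ℕ→ℚ a ≤ ℕ→ℚ b
  one-minus-ε-≤ ε@(mkℚ z d _) 0<ε {a} {b} da≤[d+1]b = toℚᵘ-cancel-≤ (begin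
    toℚᵘ ((1ℚ - ε) * ℕ→ℚ a)                       ≃⟨ toℚᵘ-homo-* (1ℚ - ε) (ℕ→ℚ a) ⟩
    toℚᵘ (1ℚ - ε) ℚᵘ.* toℚᵘ (ℕ→ℚ a)              ≃⟨ ℚᵘ.*-cong (ℚᵘ.≃-trans (toℚᵘ-homo-+ 1ℚ (- ε))
                                                                           (ℚᵘ.+-congʳ ℚᵘ.1ℚᵘ (toℚᵘ-homo‿- ε)))
                                                                (ℚᵘ.≃-reflexive (toℚᵘ-ℕ→ℚ a)) ⟩
    (ℚᵘ.1ℚᵘ ℚᵘ.- mkℚᵘ z d) ℚᵘ.* mkℚᵘ (+ a) 0      ≤⟨ one-minus-≤ᵘ (positive⇒1≤numerator 0<ε) da≤[d+1]b ⟩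
    mkℚᵘ (+ b) 0                                  ≡⟨ toℚᵘ-ℕ→ℚ b ⟨
    toℚᵘ (ℕ→ℚ b)                                  ∎)
    where open ℚᵘ.≤-Reasoning

  plus-ε-≤ : ∀ ε → 0ℚ < ε → ∀ {a} c b → a ℕ.≤ c ℕ.* b → ℕ→ℚ a ≤ (ℕ→ℚ c + ε) * ℕ→ℚ b
  plus-ε-≤ ε@(mkℚ z d _) 0<ε {a} c b a≤cb = toℚᵘ-cancel-≤ (begin
    toℚᵘ (ℕ→ℚ a)                                          ≡⟨ toℚᵘ-ℕ→ℚ a ⟩
    mkℚᵘ (+ a) 0                                          ≤⟨ plus-ε-≤ᵘ (ℤ.≤-trans (ℤ.+≤+ ℕ.z≤n) (positive⇒1≤numerator 0<ε))
                                                                       c a≤cb ⟩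
    (mkℚᵘ (+ c) 0 ℚᵘ.+ mkℚᵘ z d) ℚᵘ.* mkℚᵘ (+ b) 0        ≃⟨ ℚᵘ.*-cong (ℚᵘ.+-congˡ (mkℚᵘ z d)
                                                                                     (ℚᵘ.≃-reflexive (sym (toℚᵘ-ℕ→ℚ c))))
                                                                       (ℚᵘ.≃-reflexive (sym (toℚᵘ-ℕ→ℚ b))) ⟩
    (toℚᵘ (ℕ→ℚ c) ℚᵘ.+ toℚᵘ ε) ℚᵘ.* toℚᵘ (ℕ→ℚ b)          ≃⟨ ℚᵘ.*-cong (toℚᵘ-homo-+ (ℕ→ℚ c) ε) ℚᵘ.≃-refl ⟨
    toℚᵘ (ℕ→ℚ c + ε) ℚᵘ.* toℚᵘ (ℕ→ℚ b)                    ≃⟨ toℚᵘ-homo-* (ℕ→ℚ c + ε) (ℕ→ℚ b) ⟨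
    toℚᵘ ((ℕ→ℚ c + ε) * ℕ→ℚ b)                            ∎)
    where open ℚᵘ.≤-Reasoning

open import Defs
open import Data.Nat using (ℕ; _≤_; _*_; _∸_)
open import Data.Product using (∃; _×_)
open import Data.Rational using (ℚ; 0ℚ; 1ℚ; _<_; _-_; _+_)
open import Data.Rational using () renaming (_*_ to _*ℚ_; _≤_ to _≤ℚ_)

open import Data.Nat using (zero; suc; s≤s; z≤n)
open import Data.Nat.Properties using (≤-trans)
open import Data.Product using (_,_; proj₁)
open UpperBound using (m⁺-upper)
open LowerBound using (threshold; m⁰-lower)
open RationalBounds using (one-minus-ε-≤; plus-ε-≤)

m⁰≤m⁺ : ∀ {ℓ n k₀ k₊} → IsMZero ℓ n k₀ → IsMPlus ℓ n k₊ → k₀ ≤ k₊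
m⁰≤m⁺ ((D , free , semi) , _) (_ , bounded) with bounded D free
... | v , outdeg≤k₊ = ≤-trans (proj₁ (semi v)) outdeg≤k₊

theorem1p13 : (ℓ : ℕ) → 2 ≤ ℓ →
    (ε : ℚ) → 0ℚ < ε →
    ∃ λ N → (n : ℕ) → N ≤ n → (k₀ k₊ : ℕ) →
      IsMZero ℓ n k₀ → IsMPlus ℓ n k₊ →
        ((1ℚ - ε) *ℚ ℕ→ℚ n ≤ℚ ℕ→ℚ ((2 * ℓ ∸ 2) * (k₀ * k₀)))
      × (k₀ ≤ k₊)
      × (ℕ→ℚ (k₊ * k₊) ≤ℚ (ℕ→ℚ (4 * (ℓ * ℓ)) + ε) *ℚ ℕ→ℚ n)
theorem1p13 (suc zero) (s≤s ()) _ _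
theorem1p13 ℓ@(suc (suc L)) _ ε 0<ε = threshold L d , λ n N≤n k₀ k₊ m⁰ m⁺ →
    one-minus-ε-≤ ε 0<ε (m⁰-lower L d N≤n m⁰)
  , m⁰≤m⁺ m⁰ m⁺
  , plus-ε-≤ ε 0<ε (4 * (ℓ * ℓ)) n (m⁺-upper L (≤-trans (s≤s z≤n) N≤n) m⁺)
  where
  d : ℕ
  d = ℚ.denominator-1 ε
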